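{- Let $C$ be an $(n,k)$ circuit code of length $N\ge 2(k+1)$ with transition sequence $T=(\tau_1,\ldots,\tau_N)$ (with $\tau_i\in\{1,\ldots,n\}$), and let $q=\lceil \frac{N}{2(k+1)}\rceil$ and $r=\lceil\log_2 q\rceil+1$. Construct $T'$ as follows. Split $T$ into $T^1=(\tau_1,\ldots,\tau_{N/2})$ and $T^2=(\tau_{N/2+1},\ldots,\tau_N)$. For $i=1,2$ divide $T^i$ into consecutive segments $T^{i,1},\ldots,T^{i,q}$, where $T^{i,1}$ consists of the first $k+1$ elements of $T^i$, $T^{i,2}$ of the next $k+1$ elements, and so on (only $T^{i,q}$ may have fewer than $k+1$ elements). Let $s_l$ denote the new coordinate $n+l$ for $l=1,\ldots,r$. For $j=1,\ldots,q-1$, append $s_l$ to the end of $T^{i,j}$, where $2^{l-1}$ is the largest power of $2$ dividing $j$; append $s_r$ to the end of $T^{i,q}$ (if $q=1$, then $r=1$ and $s_r=s_1$ is appended to $T^{i,1}$). Call the resulting segments $T'^{i,1},\ldots,T'^{i,q}$, let $T'^i$ be their concatenation, and let $T'=(T'^1,T'^2)$. Let $C'$ be the cycle in $I(n+r)$ starting at $\vec 0$ with transition sequence $T'$. For a vertex $x$ of $I(n+r)$ let $x^*$ be its projection onto $I(n)$ (the first $n$ coordinates). Let $x,x'$ be vertices of $C'$ and let $\hat T$ be a shortest transition sequence in $T'$ from $x$ to $x'$ (i.e. the transition sequence of a shortest of the two paths between $x$ and $x'$ along $C'$). Then the subsequence of $\hat T$ consisting of its elements in $\{1,\ldots,n\}$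 is a shortest transition sequence in $T$ between $x^*$ and $x'^*$ (and $x^*,x'^*$ are vertices of $C$).
   Context: $I(n)$ is the $n$-dimensional hypercube graph on binary vectors of length $n$, adjacency meaning difference in exactly one coordinate. An induced subgraph $C$ of $I(n)$ is an $(n,k)$ circuit code if $C$ is a cycle and for all vertices $x,x'$ of $C$ with Hamming distance $d_{I(n)}(x,x')<k$, the distance in $C$ equals $d_{I(n)}(x,x')$. Its length $N$ (number of vertices) is even. For a cycle $C=(x_1,\ldots,x_N)$ in $I(n)$ with $x_1=\vec 0$, its transition sequence is $T=(\tau_1,\ldots,\tau_N)$ where $\tau_i$ is the coordinate in which $x_i$ and $x_{i+1}$ differ (indices mod $N$). A transition sequence between two vertices of the cycle is the cyclically consecutive segment of $T$ corresponding to one of the two paths between them along the cycle; a shortest one is one of minimal length. -}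

module Defs where

open import Data.Bool using (Bool; true; false; not; if_then_else_)
open import Data.Nat using (ℕ; zero; suc; _+_; _*_; _∸_; _≤_; _<_; _≤ᵇ_; _⊓_; _/_; _%_; _≡ᵇ_)
open import Data.Nat.Logarithm using (⌈log₂_⌉)
open import Data.Fin using (Fin; _↑ˡ_; _↑ʳ_) renaming (zero to fzero; suc to fsuc)
import Data.Fin as F
open import Data.Vec using (Vec; []; _∷_; replicate; _[_]%=_)
import Data.Vec as V
open import Data.List using (List; []; _∷_; length; take; drop; _++_; foldl; concatMap; mapMaybe; [_])
open import Data.Maybe using (Maybe; just; nothing)
open import Data.Sum using (_⊎_; inj₁; inj₂)
open import Data.Product using (_×_)
open import Relation.Binary.PropositionalEquality using (_≡_)

Vertex : ℕ → Set
Vertex n = Vec Bool n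

𝟎 : ∀ {n} → Vertex n
𝟎 = replicate _ false

flipAt : ∀ {n} → Vertex n → Fin n → Vertex n
flipAt x i = x [ i ]%= not

hamming : ∀ {n} → Vertex n → Vertex n → ℕ
hamming []       []       = 0
hamming (a ∷ xs) (b ∷ ys) = (if a Data.Bool.xor b then 1 else 0) + hamming xs ys
  where import Data.Bool

-- Walks given by transition sequences (coordinates are 0-indexed,
-- Fin n = {0,…,n-1} stands for the paper's {1,…,n}).

-- vertex reached from 𝟎 after the first i transitions of T
-- (walk T i is the paper's x_{i+1}; walk T 0 = x_1 = 𝟎)
walk : ∀ {n} → List (Fin n) → ℕ → Vertex n
walk T i = foldl flipAt 𝟎 (take i T)

fwd : ℕ → ℕ → ℕ → ℕ
fwd N a b = if a ≤ᵇ b then b ∸ a else N ∸ (a ∸ b)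

cycDist : ℕ → ℕ → ℕ → ℕ
cycDist N a b = fwd N a b ⊓ (N ∸ fwd N a b)

seg : ∀ {A : Set} → List A → ℕ → ℕ → List A
seg L a m = take m (drop a (L ++ L))

ShortestTS : ∀ {A : Set} → List A → ℕ → ℕ → List A → Set
ShortestTS L a b S =
  (d ≤ N ∸ d × S ≡ seg L a d) ⊎ (N ∸ d ≤ d × S ≡ seg L b (N ∸ d))
  where
  N = length L
  d = fwd N a b

-- (n,k) circuit codes, given by their transition sequence T
-- (the cycle C = (walk T 0, …, walk T (N-1)) with x_1 = 𝟎).

record IsCircuitCode (n k : ℕ) (T : List (Fin n)) : Set where
  field
    length≥3 : 3 ≤ length T
    closed   : walk T (length T) ≡ 𝟎
    distinct : ∀ a b → a < length T → b < length T →
               walk T a ≡ walk T b → a ≡ b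
    induced  : ∀ a b → a < length T → b < length T →
               hamming (walk T a) (walk T b) ≡ 1 → cycDist (length T) a b ≡ 1
    spread   : ∀ a b → a < length T → b < length T →
               hamming (walk T a) (walk T b) < k →
               cycDist (length T) a b ≡ hamming (walk T a) (walk T b)

ceilDivSuc : ℕ → ℕ → ℕ
ceilDivSuc m d = (m + d) / suc d

qOf : ℕ → ℕ → ℕ
qOf N k = ceilDivSuc N (suc (2 * k))

-- r = ⌈log₂ q⌉ + 1 ; we store r' = ⌈log₂ q⌉ so that r = suc r'
r'Of : ℕ → ℕ → ℕ
r'Of N k = ⌈log₂ qOf N k ⌉

ν₂-go : ℕ → ℕ → ℕ
ν₂-go zero    m = 0
ν₂-go (suc f) m = if (m % 2 ≡ᵇ 0) then suc (ν₂-go f (m / 2)) else 0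

ν₂ : ℕ → ℕ
ν₂ j = ν₂-go j j

-- l ↦ l as an element of Fin (suc r'), saturating at r'
-- (saturation never happens in the construction)
clampFin : (r' l : ℕ) → Fin (suc r')
clampFin r'       zero    = fzero
clampFin zero     (suc l) = fzero
clampFin (suc r') (suc l) = fsuc (clampFin r' l)

-- the new coordinate s_{l+1} = n + l + 1 (0-indexed: n + l)
newCoord : (n r' l : ℕ) → Fin (n + suc r')
newCoord n r' l = n ↑ʳ clampFin r' l

oldCoord : ∀ {n} r → Fin n → Fin (n + r)
oldCoord r i = i ↑ˡ r

module Construction (n k : ℕ) (T : List (Fin n)) where
  N  = length T
  h  = N / 2
  q  = qOf N k
  r' = r'Of N k
  r  = suc r'

  piece : List (Fin n) → ℕ → List (Fin n)
  piece H j = take (suc k) (drop ((j ∸ 1) * suc k) H)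

  marker : ℕ → Fin (n + r)
  marker j = if (j Data.Nat.<ᵇ q) then newCoord n r' (ν₂ j) else newCoord n r' r'
    where import Data.Nat

  piece' : List (Fin n) → ℕ → List (Fin (n + r))
  piece' H j = Data.List.map (oldCoord r) (piece H j) ++ [ marker j ]
    where import Data.List

  half' : List (Fin n) → List (Fin (n + r))
  half' H = concatMap (piece' H) (Data.List.map suc (Data.List.upTo q))
    where import Data.List

  T¹ T² : List (Fin n)
  T¹ = take h T
  T² = drop h T

  T' : List (Fin (n + r))
  T' = half' T¹ ++ half' T²

proj : ∀ {n r} → Vertex (n + r) → Vertex n
proj {n} x = V.take n x

oldPart : ∀ {n r} → List (Fin (n + r)) → List (Fin n)
oldPart {n} = mapMaybe λ c → fromSplit (F.splitAt n c)
  where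
  fromSplit : ∀ {a b} → Fin a ⊎ Fin b → Maybe (Fin a)
  fromSplit (inj₁ i) = just i
  fromSplit (inj₂ _) = nothing

-- Removing the marker coordinates from the walk along T' and projecting onto
-- I(n) gives the walk along T, so the old part of any segment of T' is a
-- segment of T read cyclically.  Both halves of T' are cut into the same number
-- of pieces of the same lengths, so they carry the same pattern of markers; hence
-- a window covering at most half of T' contains at most N/2 old coordinates.  A
-- shortest transition sequence of T' is such a window, so its old part is a
-- segment of T of length at most N/2 going the same way round the cycle, which is
-- a shortest transition sequence of T.

module Submission where

open import Defs
open import Data.Bool using (Bool; true; false; not; _xor_)
open import Data.Bool.Properties using (if-float; not-involutive; not-¬; not-distribˡ-xor; not-distribʳ-xor)
open import Data.Nat using (ℕ; zero; suc; _+_; _*_; _∸_; _<_; _≤_; z≤n; s≤s; s≤s⁻¹; z<s; _≤ᵇ_; _<ᵇ_; _%_; _⊓_; NonZero; >-nonZero; >-nonZero⁻¹)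
open import Data.Nat.Properties
open import Data.Nat.DivMod
open import Data.Nat.Divisibility using (_∣_; _∣0; ∣-refl; ∣m∣n⇒∣m+n)
open import Data.Nat.GeneralisedArithmetic using (iterate)
open import Data.Fin using (Fin; _↑ˡ_; _↑ʳ_; splitAt) renaming (zero to fzero; suc to fsuc)
open import Data.Fin.Properties using (splitAt-↑ˡ; splitAt-↑ʳ; join-splitAt)
open import Data.Vec using ([]; _∷_)
import Data.Vec as V
open import Data.List using (List; []; _∷_; length; take; drop; _++_; foldl; [_]; map; concat; applyUpTo; upTo; replicate)
open import Data.List.Properties
open import Data.Nat.ListAction using (sum)
open import Function using (_∘_; id)
open import Data.Product using (_×_; _,_; ∃-syntax)
open import Data.Sum using (_⊎_; inj₁; inj₂)
open import Relation.Binary.PropositionalEquality hiding ([_])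
open import Relation.Nullary using (contradiction; yes; no)

m≤⌈m/1+d⌉*[1+d] : ∀ m d → m ≤ ceilDivSuc m d * suc d
m≤⌈m/1+d⌉*[1+d] m d = +-cancelʳ-≤ d m (ceilDivSuc m d * suc d) (begin
  m + d                                        ≡⟨ m≡m%n+[m/n]*n (m + d) (suc d) ⟩
  (m + d) % suc d + ceilDivSuc m d * suc d     ≤⟨ +-monoˡ-≤ _ (s≤s⁻¹ (m%n<n (m + d) (suc d))) ⟩
  d + ceilDivSuc m d * suc d                   ≡⟨ +-comm d _ ⟩
  ceilDivSuc m d * suc d + d                   ∎)
  where open ≤-Reasoning

m≤n∸m⇒m+m≤n : ∀ {m n} → m ≤ n ∸ m → m + m ≤ n
m≤n∸m⇒m+m≤n {m} {n} m≤n∸m with ≤-<-connex m n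
... | inj₁ m≤n = ≤-trans (+-monoʳ-≤ m m≤n∸m) (≤-reflexive (m+[n∸m]≡n m≤n))
... | inj₂ n<m with n≤0⇒n≡0 (subst (m ≤_) (m≤n⇒m∸n≡0 (<⇒≤ n<m)) m≤n∸m)
...   | refl = z≤n

m+m≤n+n⇒m≤n : ∀ {m n} → m + m ≤ n + n → m ≤ n
m+m≤n+n⇒m≤n {m} {n} le with ≤-<-connex m n
... | inj₁ m≤n = m≤n
... | inj₂ n<m = contradiction le (<⇒≱ (+-mono-< n<m n<m))

module _ {A : Set} where

  take-++ˡ : ∀ m (xs ys : List A) → m ≤ length xs → take m (xs ++ ys) ≡ take m xs
  take-++ˡ zero    xs       ys _         = refl
  take-++ˡ (suc m) (x ∷ xs) ys (s≤s m≤) = cong (x ∷_) (take-++ˡ m xs ys m≤)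

  take-length+-++ : ∀ m (xs ys : List A) → take (length xs + m) (xs ++ ys) ≡ xs ++ take m ys
  take-length+-++ m []       ys = refl
  take-length+-++ m (x ∷ xs) ys = cong (x ∷_) (take-length+-++ m xs ys)

  drop-length-++ : ∀ (xs ys : List A) → drop (length xs) (xs ++ ys) ≡ ys
  drop-length-++ []       ys = refl
  drop-length-++ (x ∷ xs) ys = drop-length-++ xs ys

  take-length-++ : ∀ (xs ys : List A) → take (length xs) (xs ++ ys) ≡ xs
  take-length-++ xs ys = trans (take-++ˡ (length xs) xs ys ≤-refl) (take-all (length xs) xs ≤-refl)

  take-+ : ∀ m l (xs : List A) → take (m + l) xs ≡ take m xs ++ take l (drop m xs)
  take-+ zero    l xs       = refl
  take-+ (suc m) l []       = sym (take-[] l)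
  take-+ (suc m) l (x ∷ xs) = cong (x ∷_) (take-+ m l xs)

  concat-blocks : ∀ s m (xs : List A) →
    concat (applyUpTo (λ j → take s (drop (j * s) xs)) m) ≡ take (m * s) xs
  concat-blocks s zero    xs = refl
  concat-blocks s (suc m) xs = begin
    take s xs ++ concat (applyUpTo (λ j → take s (drop (s + j * s) xs)) m)
      ≡⟨ cong (λ bs → take s xs ++ concat bs) shift ⟩
    take s xs ++ concat (applyUpTo (λ j → take s (drop (j * s) (drop s xs))) m)
      ≡⟨ cong (take s xs ++_) (concat-blocks s m (drop s xs)) ⟩
    take s xs ++ take (m * s) (drop s xs)
      ≡⟨ take-+ s (m * s) xs ⟨
    take (s + m * s) xs ∎
    where
    open ≡-Reasoning
    shift : applyUpTo (λ j → take s (drop (s + j * s) xs)) m ≡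
            applyUpTo (λ j → take s (drop (j * s) (drop s xs))) m
    shift = begin
      applyUpTo _ m            ≡⟨ map-upTo _ m ⟨
      map _ (upTo m)           ≡⟨ map-cong (λ j → cong (take s) (drop-drop s (j * s) xs)) (upTo m) ⟨
      map _ (upTo m)           ≡⟨ map-upTo _ m ⟩
      applyUpTo _ m            ∎

parity : ∀ {m} → Vertex m → Bool
parity = V.foldr _ _xor_ false

parity-flipAt : ∀ {m} (x : Vertex m) i → parity (flipAt x i) ≡ not (parity x)
parity-flipAt (b ∷ x) fzero    = sym (not-distribˡ-xor b (parity x))
parity-flipAt (b ∷ x) (fsuc i) = trans (cong (b xor_) (parity-flipAt x i)) (sym (not-distribʳ-xor b (parity x)))

parity-foldl-flipAt : ∀ {m} (x : Vertex m) cs →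
  parity (foldl flipAt x cs) ≡ iterate not (parity x) (length cs)
parity-foldl-flipAt x []       = refl
parity-foldl-flipAt x (c ∷ cs) = trans (parity-foldl-flipAt (flipAt x c) cs)
  (cong (λ b → iterate not b (length cs)) (parity-flipAt x c))

iterate-not-fixed⇒2∣ : ∀ b m → iterate not b m ≡ b → 2 ∣ m
iterate-not-fixed⇒2∣ b zero          _  = 2 ∣0
iterate-not-fixed⇒2∣ b (suc zero)    eq = contradiction (sym eq) (not-¬ refl)
iterate-not-fixed⇒2∣ b (suc (suc m)) eq rewrite not-involutive b =
  ∣m∣n⇒∣m+n ∣-refl (iterate-not-fixed⇒2∣ b m eq)

closed-walk⇒2∣length : ∀ {m} (x : Vertex m) cs → foldl flipAt x cs ≡ x → 2 ∣ length cs
closed-walk⇒2∣length x cs closed = iterate-not-fixed⇒2∣ (parity x) (length cs)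
  (trans (sym (parity-foldl-flipAt x cs)) (cong parity closed))

proj-𝟎 : ∀ n r → proj {n} {r} 𝟎 ≡ 𝟎
proj-𝟎 zero    r = refl
proj-𝟎 (suc n) r = cong (false ∷_) (proj-𝟎 n r)

proj-flipAt-↑ˡ : ∀ {n} r (x : Vertex (n + r)) i → proj {n} {r} (flipAt x (i ↑ˡ r)) ≡ flipAt (proj x) i
proj-flipAt-↑ˡ r (b ∷ x) fzero    = refl
proj-flipAt-↑ˡ r (b ∷ x) (fsuc i) = cong (b ∷_) (proj-flipAt-↑ˡ r x i)

proj-flipAt-↑ʳ : ∀ n {r} (x : Vertex (n + r)) j → proj {n} {r} (flipAt x (n ↑ʳ j)) ≡ proj x
proj-flipAt-↑ʳ zero    x       j = refl
proj-flipAt-↑ʳ (suc n) (b ∷ x) j = cong (b ∷_) (proj-flipAt-↑ʳ n x j)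

module OldPart (n r : ℕ) where

  old : List (Fin (n + r)) → List (Fin n)
  old = oldPart

  oldCount : List (Fin (n + r)) → ℕ → ℕ
  oldCount cs m = length (old (take m cs))

  oldMask : List (Fin (n + r)) → List ℕ
  oldMask = map (λ c → length (old [ c ]))

  oldPart-++ : ∀ cs ds → old (cs ++ ds) ≡ old cs ++ old ds
  oldPart-++ = mapMaybe-++ _

  oldPart-↑ˡ : ∀ is → old (map (_↑ˡ r) is) ≡ is
  oldPart-↑ˡ []       = refl
  oldPart-↑ˡ (i ∷ is) rewrite splitAt-↑ˡ n i r = cong (i ∷_) (oldPart-↑ˡ is)

  oldPart-↑ʳ : ∀ j → old [ n ↑ʳ j ] ≡ []
  oldPart-↑ʳ j rewrite splitAt-↑ʳ n r j = refl

  proj-foldl-flipAt : ∀ (x : Vertex (n + r)) cs →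
    proj (foldl flipAt x cs) ≡ foldl flipAt (proj x) (old cs)
  proj-foldl-flipAt x []       = refl
  proj-foldl-flipAt x (c ∷ cs) with splitAt n c | join-splitAt n r c
  ... | inj₁ i | refl = trans (proj-foldl-flipAt (flipAt x (i ↑ˡ r)) cs)
                          (cong (λ y → foldl flipAt y (old cs)) (proj-flipAt-↑ˡ r x i))
  ... | inj₂ j | refl = trans (proj-foldl-flipAt (flipAt x (n ↑ʳ j)) cs)
                          (cong (λ y → foldl flipAt y (old cs)) (proj-flipAt-↑ʳ n x j))

  length-oldPart : ∀ cs → length (old cs) ≡ sum (oldMask cs)
  length-oldPart []       = refl
  length-oldPart (c ∷ cs) = trans (cong length (oldPart-++ [ c ] cs))
    (trans (length-++ (old [ c ])) (cong (length (old [ c ]) +_) (length-oldPart cs)))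

  oldCount-cong : ∀ {cs ds} → oldMask cs ≡ oldMask ds → ∀ m → oldCount cs m ≡ oldCount ds m
  oldCount-cong {cs} {ds} eq m = begin
    oldCount cs m              ≡⟨ length-oldPart (take m cs) ⟩
    sum (oldMask (take m cs))  ≡⟨ cong sum (take-map m cs) ⟨
    sum (take m (oldMask cs))  ≡⟨ cong (λ bs → sum (take m bs)) eq ⟩
    sum (take m (oldMask ds))  ≡⟨ cong sum (take-map m ds) ⟩
    sum (oldMask (take m ds))  ≡⟨ length-oldPart (take m ds) ⟨
    oldCount ds m              ∎
    where open ≡-Reasoning

  oldCount-++ˡ : ∀ cs ds m → m ≤ length cs → oldCount (cs ++ ds) m ≡ oldCount cs m
  oldCount-++ˡ cs ds m m≤ = cong (length ∘ old) (take-++ˡ m cs ds m≤)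

  oldCount-++ʳ : ∀ cs ds m → oldCount (cs ++ ds) (length cs + m) ≡ length (old cs) + oldCount ds m
  oldCount-++ʳ cs ds m = begin
    length (old (take (length cs + m) (cs ++ ds)))  ≡⟨ cong (length ∘ old) (take-length+-++ m cs ds) ⟩
    length (old (cs ++ take m ds))                  ≡⟨ cong length (oldPart-++ cs (take m ds)) ⟩
    length (old cs ++ old (take m ds))              ≡⟨ length-++ (old cs) ⟩
    length (old cs) + oldCount ds m                 ∎
    where open ≡-Reasoning

  oldPart-take-+ : ∀ cs m l →
    old (take (m + l) cs) ≡ old (take m cs) ++ old (take l (drop m cs))
  oldPart-take-+ cs m l = trans (cong old (take-+ m l cs)) (oldPart-++ (take m cs) _)

  oldCount-mono : ∀ cs {m m'} → m ≤ m' → oldCount cs m ≤ oldCount cs m'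
  oldCount-mono cs {m} {m'} m≤m' = begin
    oldCount cs m                                                ≤⟨ m≤m+n _ _ ⟩
    oldCount cs m + length (old (take (m' ∸ m) (drop m cs)))     ≡⟨ length-++ (old (take m cs)) ⟨
    length (old (take m cs) ++ old (take (m' ∸ m) (drop m cs)))  ≡⟨ cong length (oldPart-take-+ cs m (m' ∸ m)) ⟨
    oldCount cs (m + (m' ∸ m))                                   ≡⟨ cong (oldCount cs) (m+[n∸m]≡n m≤m') ⟩
    oldCount cs m'                                               ∎
    where open ≤-Reasoning

  oldPart-take : ∀ cs m → old (take m cs) ≡ take (oldCount cs m) (old cs)
  oldPart-take cs m = sym (begin
    take (oldCount cs m) (old cs)
      ≡⟨ cong (λ es → take (oldCount cs m) (old es)) (take++drop≡id m cs) ⟨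
    take (oldCount cs m) (old (take m cs ++ drop m cs))
      ≡⟨ cong (take (oldCount cs m)) (oldPart-++ (take m cs) (drop m cs)) ⟩
    take (oldCount cs m) (old (take m cs) ++ old (drop m cs))
      ≡⟨ take-length-++ (old (take m cs)) (old (drop m cs)) ⟩
    old (take m cs) ∎)
    where open ≡-Reasoning

  oldPart-window : ∀ cs m l →
    old (take l (drop m cs)) ≡ take (oldCount cs (m + l) ∸ oldCount cs m) (drop (oldCount cs m) (old cs))
  oldPart-window cs m l = begin
    old (take l (drop m cs))
      ≡⟨ drop-length-++ (old (take m cs)) _ ⟨
    drop c (old (take m cs) ++ old (take l (drop m cs)))
      ≡⟨ cong (drop c) (oldPart-take-+ cs m l) ⟨
    drop c (old (take (m + l) cs))
      ≡⟨ cong (drop c) (oldPart-take cs (m + l)) ⟩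
    drop c (take c′ (old cs))
      ≡⟨ cong (λ e → drop c (take e (old cs))) (m+[n∸m]≡n (oldCount-mono cs (m≤m+n m l))) ⟨
    drop c (take (c + (c′ ∸ c)) (old cs))
      ≡⟨ take-drop (c′ ∸ c) c (old cs) ⟨
    take (c′ ∸ c) (drop c (old cs)) ∎
    where
    open ≡-Reasoning
    c c′ : ℕ
    c  = oldCount cs m
    c′ = oldCount cs (m + l)

  proj-walk : ∀ cs m → proj (walk cs m) ≡ walk (old cs) (oldCount cs m)
  proj-walk cs m = begin
    proj (foldl flipAt 𝟎 (take m cs))        ≡⟨ proj-foldl-flipAt 𝟎 (take m cs) ⟩
    foldl flipAt (proj 𝟎) (old (take m cs))  ≡⟨ cong₂ (foldl flipAt) (proj-𝟎 n r) (oldPart-take cs m) ⟩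
    walk (old cs) (oldCount cs m)            ∎
    where open ≡-Reasoning

Lands : ℕ → ℕ → ℕ → ℕ → Set
Lands N x d y = x + d ≡ y ⊎ x + d ≡ N + y

module _ {N : ℕ} where

  fwd-≤ : ∀ {a b} → a ≤ b → fwd N a b ≡ b ∸ a
  fwd-≤ {a} {b} a≤b with a ≤ᵇ b | ≤⇒≤ᵇ a≤b
  ... | true | _ = refl

  fwd-> : ∀ {a b} → b < a → fwd N a b ≡ N ∸ (a ∸ b)
  fwd-> {a} {b} b<a with a ≤ᵇ b | ≤ᵇ⇒≤ a b
  ... | true  | a≤b = contradiction (a≤b _) (<⇒≱ b<a)
  ... | false | _   = refl

  fwd-self : ∀ a → fwd N a a ≡ 0
  fwd-self a = trans (fwd-≤ {a} ≤-refl) (n∸n≡0 a)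

  fwd-lands : ∀ {i j} → i < N → j < N → Lands N i (fwd N i j) j
  fwd-lands {i} {j} i<N j<N with ≤-<-connex i j
  ... | inj₁ i≤j = inj₁ (trans (cong (i +_) (fwd-≤ i≤j)) (m+[n∸m]≡n i≤j))
  ... | inj₂ j<i = inj₂ (begin
    i + fwd N i j                  ≡⟨ cong (i +_) (fwd-> j<i) ⟩
    i + (N ∸ (i ∸ j))              ≡⟨ cong (_+ (N ∸ (i ∸ j))) (m+[n∸m]≡n (<⇒≤ j<i)) ⟨
    j + (i ∸ j) + (N ∸ (i ∸ j))    ≡⟨ +-assoc j (i ∸ j) _ ⟩
    j + ((i ∸ j) + (N ∸ (i ∸ j)))  ≡⟨ cong (j +_) (m+[n∸m]≡n (≤-trans (m∸n≤m i j) (<⇒≤ i<N))) ⟩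
    j + N                          ≡⟨ +-comm j N ⟩
    N + j                          ∎)
    where open ≡-Reasoning

  fwd≤ : ∀ {i j} → j < N → fwd N i j ≤ N
  fwd≤ {i} {j} j<N with ≤-<-connex i j
  ... | inj₁ i≤j = ≤-trans (≤-reflexive (fwd-≤ i≤j)) (≤-trans (m∸n≤m j i) (<⇒≤ j<N))
  ... | inj₂ j<i = ≤-trans (≤-reflexive (fwd-> j<i)) (m∸n≤m N (i ∸ j))

  lands-back : ∀ {i d j} → d ≤ N → Lands N i d j → Lands N j (N ∸ d) i
  lands-back {i} {d} {j} d≤N (inj₁ i+d≡j) = inj₂ (begin
    j + (N ∸ d)        ≡⟨ cong (_+ (N ∸ d)) i+d≡j ⟨
    i + d + (N ∸ d)    ≡⟨ +-assoc i d (N ∸ d) ⟩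
    i + (d + (N ∸ d))  ≡⟨ cong (i +_) (m+[n∸m]≡n d≤N) ⟩
    i + N              ≡⟨ +-comm i N ⟩
    N + i              ∎)
    where open ≡-Reasoning
  lands-back {i} {d} {j} d≤N (inj₂ i+d≡N+j) = inj₁ (+-cancelʳ-≡ d (j + (N ∸ d)) i (begin
    j + (N ∸ d) + d    ≡⟨ +-assoc j (N ∸ d) d ⟩
    j + (N ∸ d + d)    ≡⟨ cong (j +_) (m∸n+n≡m d≤N) ⟩
    j + N              ≡⟨ +-comm j N ⟩
    N + j              ≡⟨ i+d≡N+j ⟨
    i + d              ∎))
    where open ≡-Reasoning

module _ {N : ℕ} .{{_ : NonZero N}} where

  fwd-+-% : ∀ {a e} → a < N → e < N → fwd N a ((a + e) % N) ≡ e
  fwd-+-% {a} {e} a<N e<N with a + e <? N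
  ... | yes a+e<N = trans (cong (fwd N a) (m<n⇒m%n≡m a+e<N)) (trans (fwd-≤ (m≤m+n a e)) (m+n∸m≡n a e))
  ... | no  a+e≮N = begin
    fwd N a ((a + e) % N)  ≡⟨ cong (fwd N a) wrapped ⟩
    fwd N a b              ≡⟨ fwd-> b<a ⟩
    N ∸ (a ∸ b)            ≡⟨ cong (N ∸_) a∸b≡N∸e ⟩
    N ∸ (N ∸ e)            ≡⟨ m∸[m∸n]≡n (<⇒≤ e<N) ⟩
    e                      ∎
    where
    open ≡-Reasoning
    b = a + e ∸ N
    b+N≡a+e : b + N ≡ a + e
    b+N≡a+e = m∸n+n≡m (≮⇒≥ a+e≮N)
    b<a : b < a
    b<a = +-cancelʳ-< N b a (subst (_< a + N) (sym b+N≡a+e) (+-monoʳ-< a e<N))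
    wrapped : (a + e) % N ≡ b
    wrapped = trans (cong (_% N) (sym b+N≡a+e)) (trans ([m+n]%n≡m%n b N) (m<n⇒m%n≡m (<-trans b<a a<N)))
    a∸b≡N∸e : a ∸ b ≡ N ∸ e
    a∸b≡N∸e = begin
      a ∸ b            ≡⟨ m+n∸n≡m (a ∸ b) e ⟨
      a ∸ b + e ∸ e    ≡⟨ cong (_∸ e) (+-∸-comm e (<⇒≤ b<a)) ⟨
      a + e ∸ b ∸ e    ≡⟨ cong (λ m → m ∸ b ∸ e) b+N≡a+e ⟨
      b + N ∸ b ∸ e    ≡⟨ cong (_∸ e) (m+n∸m≡n b N) ⟩
      N ∸ e            ∎

  [m%n+o]%n≡[m+o]%n : ∀ m o → (m % N + o) % N ≡ (m + o) % N
  [m%n+o]%n≡[m+o]%n m o = begin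
    (m % N + o) % N            ≡⟨ %-distribˡ-+ (m % N) o N ⟩
    (m % N % N + o % N) % N    ≡⟨ cong (λ x → (x + o % N) % N) (m%n%n≡m%n m N) ⟩
    (m % N + o % N) % N        ≡⟨ %-distribˡ-+ m o N ⟨
    (m + o) % N                ∎
    where open ≡-Reasoning

  m≤N∸m⇒m<N : ∀ {m} → m ≤ N ∸ m → m < N
  m≤N∸m⇒m<N {zero}  _  = >-nonZero⁻¹ N
  m≤N∸m⇒m<N {suc m} le = m∸n≢0⇒n<m λ N∸m≡0 → contradiction (subst (suc m ≤_) N∸m≡0 le) λ ()

module _ {A : Set} (T : List A) .{{_ : NonZero (length T)}} where

  shortestTS-forward : ∀ {a b e} → a < length T → e ≤ length T ∸ e → (a + e) % length T ≡ b →
    ShortestTS T a b (seg T a e)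
  shortestTS-forward {a} {e = e} a<N e≤N∸e refl = inj₁
    (subst (λ d → d ≤ length T ∸ d × seg T a e ≡ seg T a d) (sym (fwd-+-% a<N (m≤N∸m⇒m<N e≤N∸e)))
      (e≤N∸e , refl))

  shortestTS-backward : ∀ {a b e} → b < length T → e ≤ length T ∸ e → (b + e) % length T ≡ a →
    ShortestTS T a b (seg T b e)
  shortestTS-backward {a} {b} {zero} b<N _ [b+0]%N≡a = subst (λ x → ShortestTS T x b []) b≡a
    (inj₁ (subst (λ d → d ≤ length T ∸ d × [] ≡ seg T b d) (sym (fwd-self b)) (z≤n , refl)))
    where
    b≡a : b ≡ a
    b≡a = trans (sym (m<n⇒m%n≡m b<N)) (trans (cong (_% length T) (sym (+-identityʳ b))) [b+0]%N≡a)
  shortestTS-backward {a} {b} {e@(suc _)} b<N e≤N∸e [b+e]%N≡a = inj₂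
    (subst (λ d → length T ∸ d ≤ d × seg T b e ≡ seg T b (length T ∸ d)) (sym fwd≡N∸e)
      (subst (λ x → x ≤ length T ∸ e × seg T b e ≡ seg T b x) (sym (m∸[m∸n]≡n e≤N)) (e≤N∸e , refl)))
    where
    open ≡-Reasoning
    N = length T
    e≤N : e ≤ N
    e≤N = <⇒≤ (m≤N∸m⇒m<N e≤N∸e)
    [a+N∸e]%N≡b : (a + (N ∸ e)) % N ≡ b
    [a+N∸e]%N≡b = begin
      (a + (N ∸ e)) % N              ≡⟨ cong (λ x → (x + (N ∸ e)) % N) [b+e]%N≡a ⟨
      ((b + e) % N + (N ∸ e)) % N    ≡⟨ [m%n+o]%n≡[m+o]%n (b + e) (N ∸ e) ⟩
      (b + e + (N ∸ e)) % N          ≡⟨ cong (_% N) (trans (+-assoc b e (N ∸ e)) (cong (b +_) (m+[n∸m]≡n e≤N))) ⟩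
      (b + N) % N                    ≡⟨ [m+n]%n≡m%n b N ⟩
      b % N                          ≡⟨ m<n⇒m%n≡m b<N ⟩
      b                              ∎
    fwd≡N∸e : fwd N a b ≡ N ∸ e
    fwd≡N∸e = subst (λ x → fwd N a x ≡ N ∸ e) [a+N∸e]%N≡b
      (fwd-+-% (subst (_< N) [b+e]%N≡a (m%n<n (b + e) N)) (∸-monoʳ-< z<s e≤N))

  seg-% : ∀ {c e} → c ≤ length T → e ≤ length T → take e (drop c (T ++ T)) ≡ seg T (c % length T) e
  seg-% {c} {e} c≤N e≤N with m≤n⇒m<n∨m≡n c≤N
  ... | inj₁ c<N  = cong (λ x → take e (drop x (T ++ T))) (sym (m<n⇒m%n≡m c<N))
  ... | inj₂ refl = begin
    take e (drop (length T) (T ++ T))          ≡⟨ cong (take e) (drop-length-++ T T) ⟩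
    take e T                                   ≡⟨ take-++ˡ e T T e≤N ⟨
    take e (T ++ T)                            ≡⟨ cong (λ x → take e (drop x (T ++ T))) (n%n≡0 (length T)) ⟨
    take e (drop (length T % length T) (T ++ T)) ∎
    where open ≡-Reasoning

module Halves (n k : ℕ) (T : List (Fin n)) where
  open Construction n k T
  open OldPart n r

  oldPart-concat : ∀ css → old (concat css) ≡ concat (map old css)
  oldPart-concat []         = refl
  oldPart-concat (cs ∷ css) = trans (oldPart-++ cs (concat css)) (cong (old cs ++_) (oldPart-concat css))

  oldPart-marker : ∀ j → old [ marker j ] ≡ []
  oldPart-marker j = trans (cong (λ c → old [ c ]) (sym (if-float (n ↑ʳ_) (j <ᵇ q)))) (oldPart-↑ʳ _)

  oldPart-piece' : ∀ H j → old (piece' H j) ≡ piece H j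
  oldPart-piece' H j = begin
    old (map (_↑ˡ r) (piece H j) ++ [ marker j ])      ≡⟨ oldPart-++ (map (_↑ˡ r) (piece H j)) [ marker j ] ⟩
    old (map (_↑ˡ r) (piece H j)) ++ old [ marker j ]  ≡⟨ cong₂ _++_ (oldPart-↑ˡ (piece H j)) (oldPart-marker j) ⟩
    piece H j ++ []                                    ≡⟨ ++-identityʳ (piece H j) ⟩
    piece H j                                          ∎
    where open ≡-Reasoning

  oldPart-half' : ∀ H → old (half' H) ≡ take (q * suc k) H
  oldPart-half' H = begin
    old (concat (map (piece' H) js))        ≡⟨ oldPart-concat (map (piece' H) js) ⟩
    concat (map old (map (piece' H) js))    ≡⟨ cong concat (map-∘ js) ⟨
    concat (map (old ∘ piece' H) js)        ≡⟨ cong concat (map-cong (oldPart-piece' H) js) ⟩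
    concat (map (piece H) js)               ≡⟨ cong (concat ∘ map (piece H)) (map-applyUpTo id suc q) ⟩
    concat (map (piece H) (applyUpTo suc q)) ≡⟨ cong concat (map-applyUpTo suc (piece H) q) ⟩
    concat (applyUpTo (λ j → take (suc k) (drop (j * suc k) H)) q)
                                            ≡⟨ concat-blocks (suc k) q H ⟩
    take (q * suc k) H                      ∎
    where
    open ≡-Reasoning
    js : List ℕ
    js = map suc (upTo q)

  oldMask-↑ˡ : ∀ is → oldMask (map (_↑ˡ r) is) ≡ replicate (length is) 1
  oldMask-↑ˡ []       = refl
  oldMask-↑ˡ (i ∷ is) = cong₂ _∷_ (cong length (oldPart-↑ˡ [ i ])) (oldMask-↑ˡ is)

  oldMask-piece' : ∀ H j → oldMask (piece' H j) ≡ replicate (length (piece H j)) 1 ++ [ 0 ]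
  oldMask-piece' H j = trans (map-++ _ (map (_↑ˡ r) (piece H j)) [ marker j ])
    (cong₂ _++_ (oldMask-↑ˡ (piece H j)) (cong (λ cs → [ length cs ]) (oldPart-marker j)))

  length-piece : ∀ H j → length (piece H j) ≡ suc k ⊓ (length H ∸ (j ∸ 1) * suc k)
  length-piece H j = trans (length-take (suc k) (drop ((j ∸ 1) * suc k) H))
    (cong (suc k ⊓_) (length-drop ((j ∸ 1) * suc k) H))

  oldMask-half'-cong : ∀ {H H'} → length H ≡ length H' → oldMask (half' H) ≡ oldMask (half' H')
  oldMask-half'-cong {H} {H'} eq = begin
    oldMask (concat (map (piece' H) js))       ≡⟨ concat-map (map (piece' H) js) ⟨
    concat (map oldMask (map (piece' H) js))   ≡⟨ cong concat (map-∘ js) ⟨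
    concat (map (oldMask ∘ piece' H) js)       ≡⟨ cong concat (map-cong sameShape js) ⟩
    concat (map (oldMask ∘ piece' H') js)      ≡⟨ cong concat (map-∘ js) ⟩
    concat (map oldMask (map (piece' H') js))  ≡⟨ concat-map (map (piece' H') js) ⟩
    oldMask (concat (map (piece' H') js))      ∎
    where
    open ≡-Reasoning
    js : List ℕ
    js = map suc (upTo q)
    sameShape : ∀ j → oldMask (piece' H j) ≡ oldMask (piece' H' j)
    sameShape j = begin
      oldMask (piece' H j)                        ≡⟨ oldMask-piece' H j ⟩
      replicate (length (piece H j)) 1 ++ [ 0 ]   ≡⟨ cong (λ l → replicate l 1 ++ [ 0 ]) sameLength ⟩
      replicate (length (piece H' j)) 1 ++ [ 0 ]  ≡⟨ oldMask-piece' H' j ⟨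
      oldMask (piece' H' j)                       ∎
      where
      sameLength : length (piece H j) ≡ length (piece H' j)
      sameLength = trans (length-piece H j)
        (trans (cong (λ l → suc k ⊓ (l ∸ (j ∸ 1) * suc k)) eq) (sym (length-piece H' j)))

module Transfer {n k : ℕ} {T : List (Fin n)} (code : IsCircuitCode n k T) (long : 2 * suc k ≤ length T) where
  open Construction n k T
  open OldPart n r
  open Halves n k T
  open IsCircuitCode code using (closed)

  -- The length hypothesis is only needed to make N positive.
  instance
    N-nonZero : NonZero N
    N-nonZero = >-nonZero (≤-trans (s≤s z≤n) long)

  h+h≡N : h + h ≡ N
  h+h≡N = trans (cong (h +_) (sym (+-identityʳ h))) (m*[n/m]≡n 2∣N)
    where
    2∣N : 2 ∣ N
    2∣N = closed-walk⇒2∣length 𝟎 T (trans (cong (foldl flipAt 𝟎) (sym (take-all N T ≤-refl))) closed)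

  N∸h≡h : N ∸ h ≡ h
  N∸h≡h = trans (cong (_∸ h) (sym h+h≡N)) (m+n∸m≡n h h)

  h≤q*[1+k] : h ≤ q * suc k
  h≤q*[1+k] = m+m≤n+n⇒m≤n (begin
    h + h                        ≡⟨ h+h≡N ⟩
    N                            ≤⟨ m≤⌈m/1+d⌉*[1+d] N (suc (2 * k)) ⟩
    q * suc (suc (2 * k))        ≡⟨ cong (q *_) (*-suc 2 k) ⟨
    q * (suc k + (suc k + 0))    ≡⟨ *-distribˡ-+ q (suc k) (suc k + 0) ⟩
    q * suc k + q * (suc k + 0)  ≡⟨ cong (λ m → q * suc k + q * m) (+-identityʳ (suc k)) ⟩
    q * suc k + q * suc k        ∎)
    where open ≤-Reasoning

  length-T¹ : length T¹ ≡ h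
  length-T¹ = trans (length-take h T) (m≤n⇒m⊓n≡m (m/n≤m N 2))

  length-T² : length T² ≡ h
  length-T² = trans (length-drop h T) N∸h≡h

  oldPart-half'-retract : ∀ H → length H ≡ h → old (half' H) ≡ H
  oldPart-half'-retract H |H|≡h =
    trans (oldPart-half' H) (take-all _ H (subst (_≤ q * suc k) (sym |H|≡h) h≤q*[1+k]))

  H¹ H² : List (Fin (n + r))
  H¹ = half' T¹
  H² = half' T²

  P : ℕ
  P = length H¹

  oldMask-H² : oldMask H² ≡ oldMask H¹
  oldMask-H² = oldMask-half'-cong (trans length-T² (sym length-T¹))

  length-H² : length H² ≡ P
  length-H² = trans (sym (length-map _ H²)) (trans (cong length oldMask-H²) (length-map _ H¹))

  length-T' : length T' ≡ P + P
  length-T' = trans (length-++ H¹) (cong (P +_) length-H²)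

  oldPart-T' : old T' ≡ T
  oldPart-T' = begin
    old (H¹ ++ H²)    ≡⟨ oldPart-++ H¹ H² ⟩
    old H¹ ++ old H²  ≡⟨ cong₂ _++_ (oldPart-half'-retract T¹ length-T¹) (oldPart-half'-retract T² length-T²) ⟩
    T¹ ++ T²          ≡⟨ take++drop≡id h T ⟩
    T                 ∎
    where open ≡-Reasoning

  N′ : ℕ
  N′ = length T'

  -- pos m mod N is the position on C of the projection of the vertex reached
  -- after m steps along T' read cyclically.
  pos : ℕ → ℕ
  pos = oldCount (T' ++ T')

  pos≡oldCount-T' : ∀ {m} → m ≤ N′ → pos m ≡ oldCount T' m
  pos≡oldCount-T' {m} = oldCount-++ˡ T' T' m

  pos-wrap : ∀ {m} → m ≤ N′ → pos (N′ + m) ≡ N + pos m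
  pos-wrap {m} m≤N′ =
    trans (oldCount-++ʳ T' T' m) (cong₂ _+_ (cong length oldPart-T') (sym (pos≡oldCount-T' m≤N′)))

  pos≤N : ∀ {m} → m ≤ N′ → pos m ≤ N
  pos≤N {m} m≤N′ = begin
    pos m         ≤⟨ oldCount-mono (T' ++ T') m≤N′ ⟩
    pos N′        ≡⟨ cong pos (+-identityʳ N′) ⟨
    pos (N′ + 0)  ≡⟨ pos-wrap z≤n ⟩
    N + 0         ≡⟨ +-identityʳ N ⟩
    N             ∎
    where open ≤-Reasoning

  pos-half : ∀ {x} → x ≤ P + P → pos (P + x) ≡ h + pos x
  pos-half {x} x≤P+P = begin
    pos (P + x)                                ≡⟨ cong (λ cs → oldCount cs (P + x)) (++-assoc H¹ H² T') ⟩
    oldCount (H¹ ++ H² ++ T') (P + x)          ≡⟨ oldCount-++ʳ H¹ (H² ++ T') x ⟩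
    length (old H¹) + oldCount (H² ++ T') x    ≡⟨ cong₂ _+_ |old-H¹|≡h (cong (λ cs → oldCount cs x) (sym (++-assoc H² H¹ H²))) ⟩
    h + oldCount ((H² ++ H¹) ++ H²) x          ≡⟨ cong (h +_) (oldCount-++ˡ (H² ++ H¹) H² x x≤|H²H¹|) ⟩
    h + oldCount (H² ++ H¹) x                  ≡⟨ cong (h +_) (oldCount-cong swapped x) ⟩
    h + oldCount T' x                          ≡⟨ cong (h +_) (pos≡oldCount-T' (subst (x ≤_) (sym length-T') x≤P+P)) ⟨
    h + pos x                                  ∎
    where
    open ≡-Reasoning
    |old-H¹|≡h : length (old H¹) ≡ h
    |old-H¹|≡h = trans (cong length (oldPart-half'-retract T¹ length-T¹)) length-T¹
    x≤|H²H¹| : x ≤ length (H² ++ H¹)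
    x≤|H²H¹| = subst (x ≤_) (sym (trans (length-++ H²) (cong (_+ P) length-H²))) x≤P+P
    swapped : oldMask (H² ++ H¹) ≡ oldMask (H¹ ++ H²)
    swapped = trans (map-++ _ H² H¹) (trans (cong₂ _++_ oldMask-H² (sym oldMask-H²)) (sym (map-++ _ H¹ H²)))

  pos-lands : ∀ {x L y} → y < N′ → Lands N′ x L y → pos (x + L) % N ≡ pos y % N
  pos-lands             y<N′ (inj₁ x+L≡y)    = cong (λ m → pos m % N) x+L≡y
  pos-lands {x} {L} {y} y<N′ (inj₂ x+L≡N′+y) = begin
    pos (x + L) % N   ≡⟨ cong (λ m → pos m % N) x+L≡N′+y ⟩
    pos (N′ + y) % N  ≡⟨ cong (_% N) (pos-wrap (<⇒≤ y<N′)) ⟩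
    (N + pos y) % N   ≡⟨ cong (_% N) (+-comm N (pos y)) ⟩
    (pos y + N) % N   ≡⟨ [m+n]%n≡m%n (pos y) N ⟩
    pos y % N         ∎
    where open ≡-Reasoning

  oldLength : ℕ → ℕ → ℕ
  oldLength x L = pos (x + L) ∸ pos x

  oldLength≤h : ∀ {x L} → x ≤ P + P → L ≤ P → oldLength x L ≤ h
  oldLength≤h {x} {L} x≤P+P L≤P = begin
    pos (x + L) ∸ pos x  ≤⟨ ∸-monoˡ-≤ (pos x) (oldCount-mono (T' ++ T') (+-monoʳ-≤ x L≤P)) ⟩
    pos (x + P) ∸ pos x  ≡⟨ cong (λ m → pos m ∸ pos x) (+-comm x P) ⟩
    pos (P + x) ∸ pos x  ≡⟨ cong (_∸ pos x) (pos-half x≤P+P) ⟩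
    h + pos x ∸ pos x    ≡⟨ m+n∸n≡m h (pos x) ⟩
    h                    ∎
    where open ≤-Reasoning

  oldPart-seg-T' : ∀ {x L} → x ≤ N′ → L ≤ P → old (seg T' x L) ≡ seg T (pos x % N) (oldLength x L)
  oldPart-seg-T' {x} {L} x≤N′ L≤P = begin
    old (take L (drop x (T' ++ T')))                      ≡⟨ oldPart-window (T' ++ T') x L ⟩
    take (oldLength x L) (drop (pos x) (old (T' ++ T')))  ≡⟨ cong (take (oldLength x L) ∘ drop (pos x)) oldPart-T'T' ⟩
    take (oldLength x L) (drop (pos x) (T ++ T))          ≡⟨ seg-% T (pos≤N x≤N′) (≤-trans e≤h (m/n≤m N 2)) ⟩
    seg T (pos x % N) (oldLength x L)                     ∎
    where
    open ≡-Reasoning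
    e≤h : oldLength x L ≤ h
    e≤h = oldLength≤h (subst (x ≤_) length-T' x≤N′) L≤P
    oldPart-T'T' : old (T' ++ T') ≡ T ++ T
    oldPart-T'T' = trans (oldPart-++ T' T') (cong₂ _++_ oldPart-T' oldPart-T')

  transfer : ∀ {x y L} → x < N′ → y < N′ → L ≤ N′ ∸ L → Lands N′ x L y →
    oldLength x L ≤ N ∸ oldLength x L ×
    old (seg T' x L) ≡ seg T (pos x % N) (oldLength x L) ×
    (pos x % N + oldLength x L) % N ≡ pos y % N
  transfer {x} {y} {L} x<N′ y<N′ L≤N′∸L lands =
    ≤-trans e≤h (subst (_≤ N ∸ e) N∸h≡h (∸-monoʳ-≤ N e≤h)) ,
    oldPart-seg-T' (<⇒≤ x<N′) L≤P ,
    (begin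
      (pos x % N + e) % N  ≡⟨ [m%n+o]%n≡[m+o]%n (pos x) e ⟩
      (pos x + e) % N      ≡⟨ cong (_% N) (m+[n∸m]≡n (oldCount-mono (T' ++ T') (m≤m+n x L))) ⟩
      pos (x + L) % N      ≡⟨ pos-lands {x} {L} y<N′ lands ⟩
      pos y % N            ∎)
    where
    open ≡-Reasoning
    e = oldLength x L
    L≤P : L ≤ P
    L≤P = m+m≤n+n⇒m≤n (subst (L + L ≤_) length-T' (m≤n∸m⇒m+m≤n L≤N′∸L))
    e≤h : e ≤ h
    e≤h = oldLength≤h (subst (x ≤_) length-T' (<⇒≤ x<N′)) L≤P

  proj-walk-T' : ∀ {i} → i ≤ N′ → proj (walk T' i) ≡ walk T (pos i % N)
  proj-walk-T' {i} i≤N′ = begin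
    proj (walk T' i)               ≡⟨ proj-walk T' i ⟩
    walk (old T') (oldCount T' i)  ≡⟨ cong₂ walk oldPart-T' (sym (pos≡oldCount-T' i≤N′)) ⟩
    walk T (pos i)                 ≡⟨ walk-% (pos≤N i≤N′) ⟨
    walk T (pos i % N)             ∎
    where
    open ≡-Reasoning
    walk-% : ∀ {m} → m ≤ N → walk T (m % N) ≡ walk T m
    walk-% m≤N with m≤n⇒m<n∨m≡n m≤N
    ... | inj₁ m<N  = cong (walk T) (m<n⇒m%n≡m m<N)
    ... | inj₂ refl = trans (cong (walk T) (n%n≡0 N)) (sym closed)

  shortestTS-oldPart : ∀ {i j Ŝ} → i < N′ → j < N′ → ShortestTS T' i j Ŝ →
    ShortestTS T (pos i % N) (pos j % N) (old Ŝ)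
  shortestTS-oldPart {i} {j} i<N′ j<N′ (inj₁ (d≤N′∸d , Ŝ≡seg)) =
    let e≤N∸e , oldSeg , lands = transfer {i} {j} {fwd N′ i j} i<N′ j<N′ d≤N′∸d (fwd-lands i<N′ j<N′)
    in subst (ShortestTS T (pos i % N) (pos j % N)) (sym (trans (cong old Ŝ≡seg) oldSeg))
         (shortestTS-forward T (m%n<n (pos i) N) e≤N∸e lands)
  shortestTS-oldPart {i} {j} i<N′ j<N′ (inj₂ (N′∸d≤d , Ŝ≡seg)) =
    let e≤N∸e , oldSeg , lands = transfer {j} {i} {N′ ∸ fwd N′ i j} j<N′ i<N′ L≤N′∸L
                                   (lands-back (fwd≤ {i = i} j<N′) (fwd-lands i<N′ j<N′))
    in subst (ShortestTS T (pos i % N) (pos j % N)) (sym (trans (cong old Ŝ≡seg) oldSeg))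
         (shortestTS-backward T (m%n<n (pos j) N) e≤N∸e lands)
    where
    L≤N′∸L : N′ ∸ fwd N′ i j ≤ N′ ∸ (N′ ∸ fwd N′ i j)
    L≤N′∸L = subst (N′ ∸ fwd N′ i j ≤_) (sym (m∸[m∸n]≡n (fwd≤ {i = i} j<N′))) N′∸d≤d

lemma3 : (n k : ℕ) (T : List (Fin n)) → IsCircuitCode n k T →
    2 * suc k ≤ length T →
    let open Construction n k T in
    (i j : ℕ) → i < length T' → j < length T' →
    (Ŝ : List (Fin (n + r))) → ShortestTS T' i j Ŝ →
    ∃[ a ] ∃[ b ] (a < length T × b < length T ×
    walk T a ≡ proj (walk T' i) × walk T b ≡ proj (walk T' j) ×
    ShortestTS T a b (oldPart Ŝ))
lemma3 n k T code long i j i<N′ j<N′ Ŝ shortest =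
  pos i % N , pos j % N , m%n<n (pos i) N , m%n<n (pos j) N ,
  sym (proj-walk-T' (<⇒≤ i<N′)) , sym (proj-walk-T' (<⇒≤ j<N′)) ,
  shortestTS-oldPart i<N′ j<N′ shortest
  where
  open Construction n k T
  open Transfer code long
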